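{- Let $n$ be a positive integer and $1\le i\le n/2$ an integer. For a partition $\lambda=(\lambda_1,\lambda_2,\dots)$ of $n$ let $\lambda/\lambda_1=(\lambda_2,\lambda_3,\dots)$ denote the partition of $n-\lambda_1$ obtained by deleting the first row. Then $$\max_{\lambda\vdash n:\ \lambda_1=n-i}\frac{d_{\lambda/\lambda_1}}{d_\lambda}=\frac{d_{[i]}}{d_{[n-i,i]}}=\binom{n}{i}^{ -1}\frac{n-i+1}{n-2i+1}.$$
   Context: $d_\mu$ denotes the dimension of the irreducible representation of the symmetric group indexed by the partition $\mu$ (number of standard Young tableaux of shape $\mu$); $[i]$ is the one-row partition of $i$ and $[n-i,i]$ the two-row partition with rows $n-i$, $i$. -}

module Defs where

open import Data.Nat using (ℕ; zero; suc; _<_; _≥_; _<?_; pred)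
open import Data.List using (List; []; _∷_; _++_; map; [_])
open import Data.Nat.ListAction using (sum)
open import Data.List.Relation.Unary.All using (All)
open import Data.List.Relation.Unary.Linked using (Linked)
open import Data.Product using (_×_)
open import Relation.Binary.PropositionalEquality using (_≡_)
open import Relation.Nullary using (yes; no)

IsPartition : ℕ → List ℕ → Set
IsPartition n lam = (sum lam ≡ n) × Linked _≥_ lam × All (0 <_) lam

-- All shapes obtained from a partition by removing one removable corner box
-- (i.e. the possible positions of the largest entry of a standard tableau).
removals : List ℕ → List (List ℕ)
removals [] = []
removals (zero ∷ []) = []
removals (suc zero ∷ []) = [ [] ]
removals (suc (suc a) ∷ []) = [ suc a ∷ [] ]
removals (a ∷ b ∷ rest) = firstRow a b rest ++ map (a ∷_) (removals (b ∷ rest))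
  where
  firstRow : ℕ → ℕ → List ℕ → List (List ℕ)
  firstRow a b rest with b <? a
  ... | yes _ = [ pred a ∷ b ∷ rest ]
  ... | no  _ = []

-- Number of standard Young tableaux, counted by the position of the largest
-- entry (fuel = number of boxes).
dimF : ℕ → List ℕ → ℕ
dimF _ [] = 1
dimF zero (_ ∷ _) = 0
dimF (suc k) lam = sum (map (dimF k) (removals lam))

dim : List ℕ → ℕ
dim lam = dimF (sum lam) lam

-- Counting standard tableaux of λ = (a, μ) by the cell of the largest entry
-- gives d_λ ≥ d_μ · b(a, |μ|), where b(a, c) = d_[a,c] is the ballot number:
-- the largest entry ends either the first row (the case a ↦ a − 1) or a row of
-- μ (the case μ ↦ μ minus a corner), and b obeys b(a, c) ≤ b(a−1, c) + b(a, c−1).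
-- With a = n − i this bounds d_μ / d_λ by 1 / d_[n−i,i] = d_[i] / d_[n−i,i].
-- The closed form is the ballot formula b(a, c) (a + 1) = C(a+c, c) (a − c + 1),
-- which follows from the reflection principle b(a, c+1) = C(a+c+1, c+1) − C(a+c+1, c)
-- and C(a+c+1, c) (a + 1) = C(a+c+1, c+1) (c + 1).

module Submission where

open import Defs
open import Data.Nat using (ℕ; zero; suc; pred; _+_; _*_; _∸_; _≤_; _≥_; _<_; _≮_; _<?_; _≤?_; z≤n; s≤s)
open import Data.Nat.Properties
open import Data.Nat.ListAction using (sum)
open import Data.Nat.Combinatorics using (_C_; nCn≡1; nCk+nC[k+1]≡[n+1]C[k+1])
open import Data.Nat.Solver using (module +-*-Solver)
open import Data.List using (List; []; _∷_; map)
open import Data.List.Properties using (map-cong-local; map-∘)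
open import Data.List.Relation.Unary.All as All using (All; []; _∷_)
open import Data.List.Relation.Unary.Linked using (Linked; [-]; _∷_)
open import Data.Product using (_×_; _,_)
open import Algebra.Properties.CommutativeSemigroup +-commutativeSemigroup using () renaming (interchange to +-interchange)
open import Function using (_∘_)
open import Relation.Binary.PropositionalEquality using (_≡_; refl; sym; trans; cong; cong₂; subst; module ≡-Reasoning)
open import Relation.Nullary using (yes; no)
open import Relation.Nullary.Negation using (contradiction)

open +-*-Solver

sum-map-*-≤ : ∀ {A : Set} {f g : A → ℕ} {c} {xs} → All (λ x → f x * c ≤ g x) xs →
  sum (map f xs) * c ≤ sum (map g xs)
sum-map-*-≤ [] = z≤n
sum-map-*-≤ {f = f} {c = c} {xs = x ∷ xs} (le ∷ les) = begin
  (f x + sum (map f xs)) * c     ≡⟨ *-distribʳ-+ c (f x) _ ⟩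
  f x * c + sum (map f xs) * c   ≤⟨ +-mono-≤ le (sum-map-*-≤ les) ⟩
  _                              ∎
  where open ≤-Reasoning

row₁ : List ℕ → ℕ
row₁ [] = 0
row₁ (a ∷ _) = a

row₁-≤-head : ∀ {a} l → Linked _≥_ (a ∷ l) → row₁ l ≤ a
row₁-≤-head [] _ = z≤n
row₁-≤-head (_ ∷ _) (b≤a ∷ _) = b≤a

record _⋖_ (m l : List ℕ) : Set where
  constructor ⋖-intro
  field
    sum-⋖ : suc (sum m) ≡ sum l
    row₁-⋖ : row₁ m ≤ row₁ l

removals-corner : ∀ a b rest → b < a →
  removals (a ∷ b ∷ rest) ≡ (pred a ∷ b ∷ rest) ∷ map (a ∷_) (removals (b ∷ rest))
removals-corner (suc zero) b rest b<a with b <? 1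
... | yes _ = refl
... | no b≮a = contradiction b<a b≮a
removals-corner (suc (suc a)) b rest b<a with b <? suc (suc a)
... | yes _ = refl
... | no b≮a = contradiction b<a b≮a

removals-noCorner : ∀ a b rest → b ≮ a →
  removals (a ∷ b ∷ rest) ≡ map (a ∷_) (removals (b ∷ rest))
removals-noCorner zero b rest _ = refl
removals-noCorner (suc zero) b rest b≮a with b <? 1
... | yes b<a = contradiction b<a b≮a
... | no _ = refl
removals-noCorner (suc (suc a)) b rest b≮a with b <? suc (suc a)
... | yes b<a = contradiction b<a b≮a
... | no _ = refl

∷-⋖ : ∀ a {m l} → m ⋖ l → (a ∷ m) ⋖ (a ∷ l)
∷-⋖ a {m} (⋖-intro m+1≡l _) = ⋖-intro (trans (sym (+-suc a (sum m))) (cong (a +_) m+1≡l)) ≤-refl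

map-∷-⋖ : ∀ a {l ms} → All (_⋖ l) ms → All (_⋖ (a ∷ l)) (map (a ∷_) ms)
map-∷-⋖ a [] = []
map-∷-⋖ a (m⋖l ∷ ms⋖l) = ∷-⋖ a m⋖l ∷ map-∷-⋖ a ms⋖l

removals-⋖ : ∀ l → All (_⋖ l) (removals l)
removals-⋖ [] = []
removals-⋖ (zero ∷ []) = []
removals-⋖ (suc zero ∷ []) = ⋖-intro refl z≤n ∷ []
removals-⋖ (suc (suc a) ∷ []) = ⋖-intro refl (n≤1+n _) ∷ []
removals-⋖ (a ∷ b ∷ rest) = extend (removals-⋖ (b ∷ rest))
  where
  extend : All (_⋖ (b ∷ rest)) (removals (b ∷ rest)) → All (_⋖ (a ∷ b ∷ rest)) (removals (a ∷ b ∷ rest))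
  extend ih with b <? a
  ... | yes b<a@(s≤s _) rewrite removals-corner a b rest b<a = ⋖-intro refl (n≤1+n _) ∷ map-∷-⋖ a ih
  ... | no b≮a rewrite removals-noCorner a b rest b≮a = map-∷-⋖ a ih

dim-removals : ∀ l → 0 < sum l → dim l ≡ sum (map dim (removals l))
dim-removals l@(_ ∷ _) 0<l with sum l in eq
... | suc k = cong sum (map-cong-local (All.map fuel≡size (removals-⋖ l)))
  where
  fuel≡size : ∀ {m} → m ⋖ l → dimF k m ≡ dim m
  fuel≡size {m} m⋖l = cong (λ j → dimF j m) (sym (suc-injective (trans (_⋖_.sum-⋖ m⋖l) eq)))

-- Zero parts never occur in partitions, but dim*ballot≤dim does not assume
-- positive parts.
dimF-zeroRow : ∀ k l → dimF k (0 ∷ l) ≡ 0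
dimF-zeroRow zero l = refl
dimF-zeroRow (suc k) [] = refl
dimF-zeroRow (suc k) (b ∷ rest) = sumZero (removals (b ∷ rest))
  where
  sumZero : ∀ ms → sum (map (dimF k) (map (0 ∷_) ms)) ≡ 0
  sumZero [] = refl
  sumZero (m ∷ ms) rewrite dimF-zeroRow k m = sumZero ms

dim-oneRow : ∀ a → dim (suc a ∷ []) ≡ 1
dim-oneRow a rewrite +-identityʳ a = dimF-oneRow a
  where
  dimF-oneRow : ∀ a → dimF (suc a) (suc a ∷ []) ≡ 1
  dimF-oneRow zero = refl
  dimF-oneRow (suc a) = trans (+-identityʳ _) (dimF-oneRow a)

ballot : ℕ → ℕ → ℕ
ballot zero zero = 1
ballot zero (suc b) = 0
ballot (suc a) zero = 1
ballot (suc a) (suc b) with b ≤? a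
... | yes _ = ballot a (suc b) + ballot (suc a) b
... | no _ = 0

ballot-suc-suc : ∀ a b → b ≤ a → ballot (suc a) (suc b) ≡ ballot a (suc b) + ballot (suc a) b
ballot-suc-suc a b b≤a with b ≤? a
... | yes _ = refl
... | no b≰a = contradiction b≤a b≰a

ballot-suc-suc-≤ : ∀ a b → ballot (suc a) (suc b) ≤ ballot a (suc b) + ballot (suc a) b
ballot-suc-suc-≤ a b with b ≤? a
... | yes _ = ≤-refl
... | no _ = z≤n

ballot-< : ∀ {a b} → a < b → ballot a b ≡ 0
ballot-< {zero} {suc b} _ = refl
ballot-< {suc a} {suc b} (s≤s a<b) with b ≤? a
... | yes b≤a = contradiction b≤a (<⇒≱ a<b)
... | no _ = refl

row : ℕ → List ℕ
row zero = []
row (suc c) = suc c ∷ []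

removals-oneRow : ∀ b → removals (suc b ∷ []) ≡ row b ∷ []
removals-oneRow zero = refl
removals-oneRow (suc b) = refl

dim-row : ∀ c → dim (row c) ≡ 1
dim-row zero = refl
dim-row (suc c) = dim-oneRow c

dim-twoRow : ∀ a b → 0 < a → b ≤ a → dim (a ∷ row b) ≡ ballot a b
dim-twoRow (suc a) zero _ _ = dim-oneRow a
dim-twoRow (suc a) (suc c) _ (s≤s c≤a) with c <? a
... | yes c<a = begin
  dim (suc a ∷ suc c ∷ [])                          ≡⟨ dim-removals (suc a ∷ suc c ∷ []) (s≤s z≤n) ⟩
  sum (map dim (removals (suc a ∷ suc c ∷ [])))     ≡⟨ cong (sum ∘ map dim) (removals-corner (suc a) (suc c) [] (s≤s c<a)) ⟩
  dim (a ∷ suc c ∷ []) + sum (map dim (map (suc a ∷_) (removals (suc c ∷ []))))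
      ≡⟨ cong (λ rs → dim (a ∷ suc c ∷ []) + sum (map dim (map (suc a ∷_) rs))) (removals-oneRow c) ⟩
  dim (a ∷ suc c ∷ []) + (dim (suc a ∷ row c) + 0)
      ≡⟨ cong₂ _+_ (dim-twoRow a (suc c) (≤-trans (s≤s z≤n) c<a) c<a) (trans (+-identityʳ _) (dim-twoRow (suc a) c (s≤s z≤n) (m≤n⇒m≤1+n c≤a))) ⟩
  ballot a (suc c) + ballot (suc a) c               ≡⟨ sym (ballot-suc-suc a c c≤a) ⟩
  ballot (suc a) (suc c)                            ∎
  where open ≡-Reasoning
... | no c≮a = begin
  dim (suc a ∷ suc c ∷ [])                          ≡⟨ dim-removals (suc a ∷ suc c ∷ []) (s≤s z≤n) ⟩
  sum (map dim (removals (suc a ∷ suc c ∷ [])))     ≡⟨ cong (sum ∘ map dim) (removals-noCorner (suc a) (suc c) [] (c≮a ∘ ≤-pred)) ⟩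
  sum (map dim (map (suc a ∷_) (removals (suc c ∷ []))))
      ≡⟨ cong (λ rs → sum (map dim (map (suc a ∷_) rs))) (removals-oneRow c) ⟩
  dim (suc a ∷ row c) + 0                           ≡⟨ trans (+-identityʳ _) (dim-twoRow (suc a) c (s≤s z≤n) (m≤n⇒m≤1+n c≤a)) ⟩
  ballot (suc a) c                                  ≡⟨ cong (_+ ballot (suc a) c) (sym (ballot-< {a} {suc c} (s≤s (≮⇒≥ c≮a)))) ⟩
  ballot a (suc c) + ballot (suc a) c               ≡⟨ sym (ballot-suc-suc a c c≤a) ⟩
  ballot (suc a) (suc c)                            ∎
  where open ≡-Reasoning

dim*ballot≤dim : ∀ a μ → 0 < a → row₁ μ ≤ a → dim μ * ballot a (sum μ) ≤ dim (a ∷ μ)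
dim*ballot≤dim a μ = go (a + sum μ) a μ refl
  where
  go : ∀ k a μ → a + sum μ ≡ k → 0 < a → row₁ μ ≤ a → dim μ * ballot a (sum μ) ≤ dim (a ∷ μ)
  go k (suc a) [] _ _ _ = ≤-reflexive (sym (dim-oneRow a))
  go k (suc a) (zero ∷ rest) _ _ _ rewrite dimF-zeroRow (sum rest) rest = z≤n
  go (suc k) (suc a) μ@(suc b ∷ rest) a+μ≡k _ row₁μ≤a = begin
    dim μ * ballot (suc a) (suc s)
      ≤⟨ *-monoʳ-≤ (dim μ) (ballot-suc-suc-≤ a s) ⟩
    dim μ * (ballot a (suc s) + ballot (suc a) s)
      ≡⟨ *-distribˡ-+ (dim μ) _ _ ⟩
    dim μ * ballot a (suc s) + dim μ * ballot (suc a) s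
      ≤⟨ +-monoʳ-≤ (dim μ * ballot a (suc s)) lowerRows ⟩
    dim μ * ballot a (suc s) + sum (map dim (map (suc a ∷_) (removals μ)))
      ≤⟨ firstRow ⟩
    sum (map dim (removals (suc a ∷ μ)))
      ≡⟨ sym (dim-removals (suc a ∷ μ) (s≤s z≤n)) ⟩
    dim (suc a ∷ μ) ∎
    where
    open ≤-Reasoning
    s = b + sum rest
    lowerRows : dim μ * ballot (suc a) s ≤ sum (map dim (map (suc a ∷_) (removals μ)))
    lowerRows = begin
      dim μ * ballot (suc a) s
        ≡⟨ cong (_* ballot (suc a) s) (dim-removals μ (s≤s z≤n)) ⟩
      sum (map dim (removals μ)) * ballot (suc a) s
        ≤⟨ sum-map-*-≤ (All.map extendFirstRow (removals-⋖ μ)) ⟩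
      sum (map (dim ∘ (suc a ∷_)) (removals μ))
        ≡⟨ cong sum (map-∘ (removals μ)) ⟩
      sum (map dim (map (suc a ∷_) (removals μ))) ∎
      where
      extendFirstRow : ∀ {m} → m ⋖ μ → dim m * ballot (suc a) s ≤ dim (suc a ∷ m)
      extendFirstRow {m} (⋖-intro m+1≡μ m≤μ) =
        subst (λ t → dim m * ballot (suc a) t ≤ dim (suc a ∷ m)) (suc-injective m+1≡μ)
          (go k (suc a) m fuel (s≤s z≤n) (≤-trans m≤μ row₁μ≤a))
        where
        fuel : suc a + sum m ≡ k
        fuel = trans (sym (+-suc a (sum m))) (trans (cong (a +_) m+1≡μ) (suc-injective a+μ≡k))
    -- Without a corner at the end of the first row (b = a) the term vanishes: a < suc s.
    firstRow : dim μ * ballot a (suc s) + sum (map dim (map (suc a ∷_) (removals μ)))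
             ≤ sum (map dim (removals (suc a ∷ μ)))
    firstRow with b <? a
    ... | yes b<a rewrite removals-corner (suc a) (suc b) rest (s≤s b<a) =
      +-monoˡ-≤ _ (go k a μ (suc-injective a+μ≡k) (≤-trans (s≤s z≤n) b<a) b<a)
    ... | no b≮a rewrite removals-noCorner (suc a) (suc b) rest (b≮a ∘ ≤-pred)
                       | ballot-< {a} {suc s} (s≤s (≤-trans (≮⇒≥ b≮a) (m≤m+n b (sum rest))))
                       | *-zeroʳ (dim μ) = ≤-refl

paths : ℕ → ℕ → ℕ
paths zero q = 1
paths (suc p) zero = 1
paths (suc p) (suc q) = paths p (suc q) + paths (suc p) q

paths-comm : ∀ p q → paths p q ≡ paths q p
paths-comm zero zero = refl
paths-comm zero (suc q) = refl
paths-comm (suc p) zero = refl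
paths-comm (suc p) (suc q) rewrite paths-comm p (suc q) | paths-comm (suc p) q =
  +-comm (paths (suc q) p) (paths q (suc p))

paths-1 : ∀ q → paths 1 q ≡ suc q
paths-1 zero = refl
paths-1 (suc q) = cong suc (paths-1 q)

C≡paths : ∀ p q → (p + q) C q ≡ paths p q
C≡paths zero zero = refl
C≡paths (suc p) zero = refl
C≡paths zero (suc q) = nCn≡1 (suc q)
C≡paths (suc p) (suc q) = begin
  suc (p + suc q) C suc q                 ≡⟨ sym (nCk+nC[k+1]≡[n+1]C[k+1] (p + suc q) q) ⟩
  (p + suc q) C q + (p + suc q) C suc q   ≡⟨ cong₂ _+_ (trans (cong (_C q) (+-suc p q)) (C≡paths (suc p) q)) (C≡paths p (suc q)) ⟩
  paths (suc p) q + paths p (suc q)       ≡⟨ +-comm (paths (suc p) q) _ ⟩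
  paths p (suc q) + paths (suc p) q       ∎
  where open ≡-Reasoning

paths-absorb : ∀ p q → paths (suc p) q * suc p ≡ paths p (suc q) * suc q
paths-absorb zero q rewrite paths-1 q = trans (*-identityʳ (suc q)) (sym (*-identityˡ (suc q)))
paths-absorb (suc p) zero =
  trans (*-identityˡ _) (sym (trans (*-identityʳ _) (trans (paths-comm (suc p) 1) (paths-1 (suc p)))))
paths-absorb (suc p) (suc q) = begin
  (X + paths (suc (suc p)) q) * suc (suc p)            ≡⟨ *-distribʳ-+ (suc (suc p)) X _ ⟩
  X * suc (suc p) + paths (suc (suc p)) q * suc (suc p) ≡⟨ cong (X * suc (suc p) +_) (paths-absorb (suc p) q) ⟩
  X * suc (suc p) + X * suc q                           ≡⟨ shift X p q ⟩
  X * suc p + X * suc (suc q)                           ≡⟨ cong (_+ X * suc (suc q)) (paths-absorb p (suc q)) ⟩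
  paths p (suc (suc q)) * suc (suc q) + X * suc (suc q) ≡⟨ sym (*-distribʳ-+ (suc (suc q)) (paths p (suc (suc q))) X) ⟩
  (paths p (suc (suc q)) + X) * suc (suc q)            ∎
  where
  open ≡-Reasoning
  X = paths (suc p) (suc q)
  shift : ∀ x p q → x * suc (suc p) + x * suc q ≡ x * suc p + x * suc (suc q)
  shift = solve 3 (λ x p q → x :* (con 2 :+ p) :+ x :* (con 1 :+ q) := x :* (con 1 :+ p) :+ x :* (con 2 :+ q)) refl

-- André's reflection principle: ballot a b = C(a+b, b) − C(a+b, b−1).
ballot+paths≡paths : ∀ a b → b ≤ a → ballot a (suc b) + paths (suc a) b ≡ paths a (suc b)
ballot+paths≡paths zero zero _ = refl
ballot+paths≡paths (suc a) b b≤a with b ≤? a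
ballot+paths≡paths (suc a) zero _ | yes _ = cong (_+ 1) (ballot+paths≡paths a zero z≤n)
ballot+paths≡paths (suc a) (suc c) 1+c≤1+a | yes c≤a = begin
  (ballot a (suc (suc c)) + ballot (suc a) (suc c)) + (paths (suc a) (suc c) + paths (suc (suc a)) c)
    ≡⟨ +-interchange (ballot a (suc (suc c))) (ballot (suc a) (suc c)) (paths (suc a) (suc c)) (paths (suc (suc a)) c) ⟩
  (ballot a (suc (suc c)) + paths (suc a) (suc c)) + (ballot (suc a) (suc c) + paths (suc (suc a)) c)
    ≡⟨ cong₂ _+_ (ballot+paths≡paths a (suc c) c≤a) (ballot+paths≡paths (suc a) c (≤-trans (n≤1+n c) 1+c≤1+a)) ⟩
  paths a (suc (suc c)) + paths (suc a) (suc c) ∎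
  where open ≡-Reasoning
... | no b≰a rewrite ≤-antisym b≤a (≮⇒≥ (b≰a ∘ ≤-pred)) = paths-comm (suc (suc a)) (suc a)

ballot-hook : ∀ a b → b ≤ a → paths a b * (a ∸ b + 1) ≡ ballot a b * (a + 1)
ballot-hook zero zero _ = refl
ballot-hook (suc a) zero _ = refl
ballot-hook a (suc c) c<a = +-cancelʳ-≡ (P * suc c) _ _ (begin
  P * (a ∸ suc c + 1) + P * suc c                         ≡⟨ sym (*-distribˡ-+ P (a ∸ suc c + 1) (suc c)) ⟩
  P * (a ∸ suc c + 1 + suc c)                             ≡⟨ cong (P *_) a∸b+1+b≡a+1 ⟩
  P * (a + 1)                                             ≡⟨ cong (_* (a + 1)) (sym (ballot+paths≡paths a c (≤-trans (n≤1+n c) c<a))) ⟩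
  (B + paths (suc a) c) * (a + 1)                         ≡⟨ *-distribʳ-+ (a + 1) B _ ⟩
  B * (a + 1) + paths (suc a) c * (a + 1)                 ≡⟨ cong (λ t → B * (a + 1) + paths (suc a) c * t) (+-comm a 1) ⟩
  B * (a + 1) + paths (suc a) c * suc a                   ≡⟨ cong (B * (a + 1) +_) (paths-absorb a c) ⟩
  B * (a + 1) + P * suc c                                 ∎)
  where
  open ≡-Reasoning
  P = paths a (suc c)
  B = ballot a (suc c)
  a∸b+1+b≡a+1 : a ∸ suc c + 1 + suc c ≡ a + 1
  a∸b+1+b≡a+1 = begin
    a ∸ suc c + 1 + suc c   ≡⟨ +-assoc (a ∸ suc c) 1 (suc c) ⟩
    a ∸ suc c + suc (suc c) ≡⟨ +-suc (a ∸ suc c) (suc c) ⟩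
    suc (a ∸ suc c + suc c) ≡⟨ cong suc (m∸n+n≡m c<a) ⟩
    suc a                   ≡⟨ +-comm 1 a ⟩
    a + 1                   ∎

firstRowDeletion-ratio-≤ : ∀ a μ → 0 < a → sum μ ≤ a → Linked _≥_ (a ∷ μ) →
  dim μ * dim (a ∷ row (sum μ)) ≤ dim (row (sum μ)) * dim (a ∷ μ)
firstRowDeletion-ratio-≤ a μ 0<a μ≤a sorted = begin
  dim μ * dim (a ∷ row (sum μ))    ≡⟨ cong (dim μ *_) (dim-twoRow a (sum μ) 0<a μ≤a) ⟩
  dim μ * ballot a (sum μ)         ≤⟨ dim*ballot≤dim a μ 0<a (row₁-≤-head μ sorted) ⟩
  dim (a ∷ μ)                      ≡⟨ sym (*-identityˡ _) ⟩
  1 * dim (a ∷ μ)                  ≡⟨ cong (_* dim (a ∷ μ)) (sym (dim-row (sum μ))) ⟩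
  dim (row (sum μ)) * dim (a ∷ μ)  ∎
  where open ≤-Reasoning

twoRow-hookFormula : ∀ a c → 0 < a → c ≤ a →
  dim (row c) * (((a + c) C c) * (a ∸ c + 1)) ≡ dim (a ∷ row c) * (a + 1)
twoRow-hookFormula a c 0<a c≤a = begin
  dim (row c) * (((a + c) C c) * (a ∸ c + 1))  ≡⟨ cong (_* (((a + c) C c) * (a ∸ c + 1))) (dim-row c) ⟩
  1 * (((a + c) C c) * (a ∸ c + 1))            ≡⟨ *-identityˡ _ ⟩
  ((a + c) C c) * (a ∸ c + 1)                  ≡⟨ cong (_* (a ∸ c + 1)) (C≡paths a c) ⟩
  paths a c * (a ∸ c + 1)                      ≡⟨ ballot-hook a c c≤a ⟩
  ballot a c * (a + 1)                         ≡⟨ cong (_* (a + 1)) (sym (dim-twoRow a c 0<a c≤a)) ⟩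
  dim (a ∷ row c) * (a + 1)                    ∎
  where open ≡-Reasoning

mainTheorem9 : (n i : ℕ) → 1 ≤ i → 2 * i ≤ n →
    ((a : ℕ) (rest : List ℕ) → IsPartition n (a ∷ rest) → a ≡ n ∸ i →
       dim rest * dim (n ∸ i ∷ i ∷ []) ≤ dim (i ∷ []) * dim (a ∷ rest))
    × IsPartition n (n ∸ i ∷ i ∷ [])
    × (dim (i ∷ []) * ((n C i) * (n ∸ 2 * i + 1)) ≡ dim (n ∸ i ∷ i ∷ []) * (n ∸ i + 1))
mainTheorem9 n i@(suc _) 1≤i 2i≤n = upperBound , twoRowPartition , hookFormula
  where
  a = n ∸ i
  i≤a : i ≤ a
  i≤a = m+n≤o⇒m≤o∸n i (subst (_≤ n) (cong (i +_) (+-identityʳ i)) 2i≤n)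
  0<a : 0 < a
  0<a = ≤-trans 1≤i i≤a
  a+i≡n : a + i ≡ n
  a+i≡n = m∸n+n≡m (≤-trans i≤a (m∸n≤m n i))

  upperBound : (a₀ : ℕ) (rest : List ℕ) → IsPartition n (a₀ ∷ rest) → a₀ ≡ a →
               dim rest * dim (a ∷ i ∷ []) ≤ dim (i ∷ []) * dim (a₀ ∷ rest)
  upperBound .a rest (a+rest≡n , sorted , _) refl =
    subst (λ c → dim rest * dim (a ∷ row c) ≤ dim (row c) * dim (a ∷ rest)) rest≡i
      (firstRowDeletion-ratio-≤ a rest 0<a (subst (_≤ a) (sym rest≡i) i≤a) sorted)
    where
    rest≡i : sum rest ≡ i
    rest≡i = +-cancelˡ-≡ a (sum rest) i (trans a+rest≡n (sym a+i≡n))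

  twoRowPartition : IsPartition n (a ∷ i ∷ [])
  twoRowPartition = trans (cong (a +_) (+-identityʳ i)) a+i≡n , (i≤a ∷ [-]) , (0<a ∷ 1≤i ∷ [])

  hookFormula : dim (i ∷ []) * ((n C i) * (n ∸ 2 * i + 1)) ≡ dim (a ∷ i ∷ []) * (a + 1)
  hookFormula = trans (cong₂ (λ m k → dim (i ∷ []) * ((m C i) * (k + 1))) (sym a+i≡n) n∸2i≡a∸i)
                      (twoRow-hookFormula a i 0<a i≤a)
    where
    n∸2i≡a∸i : n ∸ 2 * i ≡ a ∸ i
    n∸2i≡a∸i = trans (sym (∸-+-assoc n i (i + 0))) (cong (a ∸_) (+-identityʳ i))
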